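{- Let $G$ be a finite abelian group of order $n$ and let $\{A_1,A_2\}$ be an $(n,2;k_1,k_2;\ell)$-RWEDF in $G$. Then $\ell=\frac{k_1+k_2}{n-1}$, and either $k_1=k_2=k$ and $\{A_1,A_2\}$ is an $\left(n,2,k,\frac{2k^2}{n-1}\right)$-EDF, or $\{A_1,A_2\}$ is an $\left(n,2;k_1,k_2;\frac{k_1k_2}{n-1},\frac{k_1k_2}{n-1}\right)$-GSEDF.
   Context: $G$ is written additively, $G^*=G\setminus\{0\}$. For pairwise disjoint nonempty subsets $A_1,\dots,A_m$ of $G$ and $\delta\in G^*$, let $N_i(\delta)=|\{(a_i,a_j): a_i\in A_i,\ a_j\in A_j \text{ for some } j\neq i,\ a_i-a_j=\delta\}|$. An $(n,m;k_1,\dots,k_m;\ell)$-RWEDF is a collection of pairwise disjoint subsets with $|A_i|=k_i$ such that $\sum_i \frac{1}{k_i}N_i(\delta)=\ell$ for all $\delta\in G^*$. An $(n,m,k,\lambda)$-EDF is a collection of $m$ pairwise disjoint $k$-subsets with $\sum_i N_i(\delta)=\lambda$ for all $\delta\in G^*$. An $(n,m;k_1,\dots,k_m;\lambda_1,\dots,\lambda_m)$-GSEDF is a collection of pairwise disjoint subsets with $|A_i|=k_i$ and $N_i(\delta)=\lambda_i$ for all $\delta\in G^*$ and all $i$. -}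

module Defs where

open import Level using (0ℓ)
open import Data.Bool using (Bool; true; false; if_then_else_; _∧_; _∨_; not)
open import Data.Nat using (ℕ; zero; suc; _+_; _*_; _∸_)
open import Data.Fin using (Fin; _≟_)
open import Data.Fin.Subset using (Subset; _∈_; ∣_∣)
open import Data.Vec using (lookup)
open import Data.Integer using (+_)
open import Data.Rational using (ℚ; _/_; 0ℚ) renaming (_+_ to _+ℚ_)
open import Data.Product using (Σ; ∃; _×_; _,_)
open import Data.Empty using (⊥)
open import Relation.Nullary using (¬_; does)
open import Relation.Binary.PropositionalEquality using (_≡_; _≢_)
open import Algebra.Structures using (IsAbelianGroup)

-- A finite abelian group of order n, represented on the carrier Fin n
-- (every finite abelian group of order n is isomorphic to such a one).
record FinAbGroup (n : ℕ) : Set where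
  field
    _⊕_ : Fin n → Fin n → Fin n
    𝟘   : Fin n
    ⊖_  : Fin n → Fin n
    isAbelianGroup : IsAbelianGroup _≡_ _⊕_ 𝟘 ⊖_

  _⊝_ : Fin n → Fin n → Fin n
  a ⊝ b = a ⊕ (⊖ b)

ΣFin : (n : ℕ) → (Fin n → ℕ) → ℕ
ΣFin zero    f = 0
ΣFin (suc n) f = f Fin.zero + ΣFin n (λ i → f (Fin.suc i))

ΣFinℚ : (n : ℕ) → (Fin n → ℚ) → ℚ
ΣFinℚ zero    f = 0ℚ
ΣFinℚ (suc n) f = f Fin.zero +ℚ ΣFinℚ n (λ i → f (Fin.suc i))

anyFin : (m : ℕ) → (Fin m → Bool) → Bool
anyFin zero    f = false
anyFin (suc m) f = f Fin.zero ∨ anyFin m (λ i → f (Fin.suc i))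

-- a / d as a rational; d = 0 is given the junk value 0 (never used when d ≥ 1)
divℕ : ℕ → ℕ → ℚ
divℕ a zero    = 0ℚ
divℕ a (suc d) = (+ a) / suc d

bool→ℕ : Bool → ℕ
bool→ℕ true  = 1
bool→ℕ false = 0

module _ {n : ℕ} (G : FinAbGroup n) where
  open FinAbGroup G

  inOther : {m : ℕ} → (Fin m → Subset n) → Fin m → Fin n → Bool
  inOther {m} A i b = anyFin m (λ j → not (does (j ≟ i)) ∧ lookup (A j) b)

  N : {m : ℕ} → (Fin m → Subset n) → Fin m → Fin n → ℕ
  N A i δ = ΣFin n (λ a → ΣFin n (λ b →
              bool→ℕ (lookup (A i) a ∧ inOther A i b ∧ does ((a ⊝ b) ≟ δ))))

  IsFamily : {m : ℕ} → (Fin m → Subset n) → (Fin m → ℕ) → Set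
  IsFamily A k =
    (∀ i j → i ≢ j → ∀ x → x ∈ A i → x ∈ A j → ⊥) ×
    (∀ i → ∃ λ x → x ∈ A i) ×
    (∀ i → ∣ A i ∣ ≡ k i)

  IsRWEDF : {m : ℕ} → (Fin m → Subset n) → (Fin m → ℕ) → ℚ → Set
  IsRWEDF {m} A k ℓ = IsFamily A k ×
    (∀ δ → δ ≢ 𝟘 → ΣFinℚ m (λ i → divℕ (N A i δ) (k i)) ≡ ℓ)

  IsEDF : {m : ℕ} → (Fin m → Subset n) → ℕ → ℕ → Set
  IsEDF {m} A k λ' = IsFamily A (λ _ → k) ×
    (∀ δ → δ ≢ 𝟘 → ΣFin m (λ i → N A i δ) ≡ λ')

  IsGSEDF : {m : ℕ} → (Fin m → Subset n) → (Fin m → ℕ) → (Fin m → ℕ) → Set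
  IsGSEDF A k λs = IsFamily A k ×
    (∀ i δ → δ ≢ 𝟘 → N A i δ ≡ λs i)

module Submission where

-- Let {A₁, A₂} be a two-set family in a finite abelian group G of order n,
-- with p = |A₁|, q = |A₂|, and write N₁, N₂ for its external difference
-- counts.  N₁(δ) counts the pairs (a, b) ∈ A₁ × A₂ with a - b = δ, so
--   (i)   N₁(0) = N₂(0) = 0, since A₁ and A₂ are disjoint;
--   (ii)  Σ_δ N₁(δ) = Σ_δ N₂(δ) = pq, since every pair has exactly one difference;
--   (iii) N₂(δ) = N₁(-δ).
-- The RWEDF condition N₁(δ)/p + N₂(δ)/q = ℓ says that c = q N₁(δ) + p N₂(δ) is
-- the same for every δ ≠ 0, and ℓ = c/(pq).  Summing over the n - 1 nonzero δ
-- gives (n - 1) c = pq (p + q), hence ℓ = (p + q)/(n - 1).  If p = q, then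
-- N₁ + N₂ = c/p is constant: an EDF with (n - 1) λ = 2p².  If p ≠ q, comparing
-- the balance at δ and at -δ via (iii) gives (q - p)(N₁(δ) - N₂(δ)) = 0, so
-- N₁ = N₂ = c/(p + q) is constant: a GSEDF with (n - 1) λ = pq.

open import Defs
open import Data.Nat using (ℕ; _+_; _*_; _∸_)
open import Data.Fin using (Fin; zero; suc)
open import Data.Fin.Subset using (Subset)
open import Data.Rational using (ℚ)
open import Data.Product using (Σ; _×_)
open import Data.Sum using (_⊎_)
open import Relation.Binary.PropositionalEquality using (_≡_)

open import Level using (0ℓ)
open import Algebra.Bundles using (Group)
open import Algebra.Structures using (IsAbelianGroup)
import Algebra.Properties.CommutativeSemigroup as CommSemigroupProperties
import Algebra.Properties.Group as GroupProperties
open import Data.Bool using (true; false; _∧_)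
open import Data.Bool.Properties using (∧-assoc; ∧-comm; ∨-identityʳ)
open import Data.Empty using (⊥; ⊥-elim)
open import Data.Fin using (_≟_)
open import Data.Fin.Subset using (_∈_; ∣_∣; inside; outside)
import Data.Integer as ℤ
import Data.Integer.Properties as ℤₚ
open import Data.Nat using (zero; suc; NonZero)
import Data.Nat as ℕ
open import Data.Nat.Properties
  using (+-identityʳ; *-zeroʳ; *-identityʳ; *-comm; *-distribˡ-+; *-distribʳ-+;
         +-cancelˡ-≡; *-cancelˡ-≡; *-cancelʳ-≡; ≤-total; m≤n⇒∃[o]m+o≡n;
         m*n≢0; +-commutativeSemigroup)
open import Data.Nat.Tactic.RingSolver using (solve-∀)
open import Data.Product using (_,_; proj₁; proj₂)
open import Data.Rational using (0ℚ; fromℚᵘ) renaming (_+_ to _+ℚ_; _/_ to _/ℚ_)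
import Data.Rational.Properties as ℚ
open import Data.Rational.Unnormalised using (ℚᵘ; mkℚᵘ; *≡*) renaming (_+_ to _+ᵘ_)
import Data.Rational.Unnormalised.Properties as ℚᵘ
open import Data.Sum using (inj₁; inj₂)
open import Data.Vec using ([]; _∷_; lookup; here; there)
open import Data.Vec.Properties using (lookup⇒[]=)
open import Function.Bundles using (mk⇔)
open import Relation.Binary.PropositionalEquality
  using (_≢_; refl; sym; trans; cong; cong₂; subst; module ≡-Reasoning)
open import Relation.Nullary using (does; yes; no)
open import Relation.Nullary.Decidable using (does-⇔)
open ≡-Reasoning

divℕ-cross⇒≡ : ∀ x y c d .{{_ : NonZero c}} .{{_ : NonZero d}} →
               x * d ≡ y * c → divℕ x c ≡ divℕ y d
divℕ-cross⇒≡ x y (suc c) (suc d) xd≡yc = ℚ.fromℚᵘ-cong {mkℚᵘ (ℤ.+ x) c} {mkℚᵘ (ℤ.+ y) d}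
  (*≡* (trans (sym (ℤₚ.pos-* x (suc d))) (trans (cong ℤ.+_ xd≡yc) (ℤₚ.pos-* y (suc c)))))

divℕ-≡⇒cross : ∀ x y c d .{{_ : NonZero c}} .{{_ : NonZero d}} →
               divℕ x c ≡ divℕ y d → x * d ≡ y * c
divℕ-≡⇒cross x y (suc c) (suc d) = ℚ.normalize-injective-≃ x y (suc c) (suc d)

divℕ-injectiveˡ : ∀ x y d .{{_ : NonZero d}} → divℕ x d ≡ divℕ y d → x ≡ y
divℕ-injectiveˡ x y d eq = *-cancelʳ-≡ x y d (divℕ-≡⇒cross x y d d eq)

fromℚᵘ-+ : (r s : ℚᵘ) → fromℚᵘ r +ℚ fromℚᵘ s ≡ fromℚᵘ (r +ᵘ s)
fromℚᵘ-+ r s = ℚ.toℚᵘ-injective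
  (ℚᵘ.≃-trans (ℚ.toℚᵘ-homo-+ (fromℚᵘ r) (fromℚᵘ s))
  (ℚᵘ.≃-trans (ℚᵘ.+-cong (ℚ.toℚᵘ-fromℚᵘ r) (ℚ.toℚᵘ-fromℚᵘ s))
              (ℚᵘ.≃-sym (ℚ.toℚᵘ-fromℚᵘ (r +ᵘ s)))))

divℕ-+ : ∀ x y c d .{{_ : NonZero c}} .{{_ : NonZero d}} →
         divℕ x c +ℚ divℕ y d ≡ divℕ (x * d + y * c) (c * d)
divℕ-+ x y (suc c) (suc d) = trans (fromℚᵘ-+ (mkℚᵘ (ℤ.+ x) c) (mkℚᵘ (ℤ.+ y) d))
  (cong (_/ℚ (suc c * suc d)) (sym numerator))
  where
  numerator : ℤ.+ (x * suc d + y * suc c) ≡ ℤ.+ x ℤ.* ℤ.+ suc d ℤ.+ ℤ.+ y ℤ.* ℤ.+ suc c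
  numerator = trans (ℤₚ.pos-+ (x * suc d) (y * suc c))
                    (cong₂ ℤ._+_ (ℤₚ.pos-* x (suc d)) (ℤₚ.pos-* y (suc c)))

ΣFin-cong : ∀ n {f g : Fin n → ℕ} → (∀ i → f i ≡ g i) → ΣFin n f ≡ ΣFin n g
ΣFin-cong zero    f≗g = refl
ΣFin-cong (suc n) f≗g = cong₂ _+_ (f≗g zero) (ΣFin-cong n (λ i → f≗g (suc i)))

ΣFin-+ : ∀ n (f g : Fin n → ℕ) → ΣFin n (λ i → f i + g i) ≡ ΣFin n f + ΣFin n g
ΣFin-+ zero    f g = refl
ΣFin-+ (suc n) f g =
  trans (cong (f zero + g zero +_) (ΣFin-+ n (λ i → f (suc i)) (λ i → g (suc i))))
        (CommSemigroupProperties.interchange +-commutativeSemigroup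
          (f zero) (g zero) (ΣFin n (λ i → f (suc i))) (ΣFin n (λ i → g (suc i))))

ΣFin-*ˡ : ∀ n c (f : Fin n → ℕ) → ΣFin n (λ i → c * f i) ≡ c * ΣFin n f
ΣFin-*ˡ zero    c f = sym (*-zeroʳ c)
ΣFin-*ˡ (suc n) c f = trans (cong (c * f zero +_) (ΣFin-*ˡ n c (λ i → f (suc i))))
                            (sym (*-distribˡ-+ c (f zero) _))

ΣFin-*ʳ : ∀ n c (f : Fin n → ℕ) → ΣFin n (λ i → f i * c) ≡ ΣFin n f * c
ΣFin-*ʳ n c f = trans (ΣFin-cong n (λ i → *-comm (f i) c))
                      (trans (ΣFin-*ˡ n c f) (*-comm c (ΣFin n f)))

ΣFin-const : ∀ n c {f : Fin n → ℕ} → (∀ i → f i ≡ c) → ΣFin n f ≡ n * c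
ΣFin-const zero    c f≡c = refl
ΣFin-const (suc n) c f≡c = cong₂ _+_ (f≡c zero) (ΣFin-const n c (λ i → f≡c (suc i)))

ΣFin-zero : ∀ n {f : Fin n → ℕ} → (∀ i → f i ≡ 0) → ΣFin n f ≡ 0
ΣFin-zero n f≡0 = trans (ΣFin-const n 0 f≡0) (*-zeroʳ n)

ΣFin-swap : ∀ n m (f : Fin n → Fin m → ℕ) →
            ΣFin n (λ a → ΣFin m (f a)) ≡ ΣFin m (λ b → ΣFin n (λ a → f a b))
ΣFin-swap zero    m f = sym (ΣFin-zero m (λ _ → refl))
ΣFin-swap (suc n) m f =
  trans (cong (ΣFin m (f zero) +_) (ΣFin-swap n m (λ a → f (suc a))))
        (sym (ΣFin-+ m (f zero) (λ b → ΣFin n (λ a → f (suc a) b))))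

ΣFin-punctured : ∀ n c (f : Fin n → ℕ) (z : Fin n) →
                 f z ≡ 0 → (∀ i → i ≢ z → f i ≡ c) → ΣFin n f ≡ (n ∸ 1) * c
ΣFin-punctured (suc n) c f zero fz≡0 f≡c =
  cong₂ _+_ fz≡0 (ΣFin-const n c (λ i → f≡c (suc i) (λ ())))
ΣFin-punctured (suc (suc n)) c f (suc z) fz≡0 f≡c =
  cong₂ _+_ (f≡c zero (λ ()))
    (ΣFin-punctured (suc n) c (λ i → f (suc i)) z fz≡0
      (λ i i≢z → f≡c (suc i) (λ { refl → i≢z refl })))

ΣFin-indicator : ∀ n (e : Fin n) → ΣFin n (λ d → bool→ℕ (does (e ≟ d))) ≡ 1
ΣFin-indicator (suc n) zero    = cong suc (ΣFin-zero n (λ _ → refl))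
ΣFin-indicator (suc n) (suc e) = ΣFin-indicator n e

size≡ΣFin : ∀ {n} (S : Subset n) → ∣ S ∣ ≡ ΣFin n (λ a → bool→ℕ (lookup S a))
size≡ΣFin []            = refl
size≡ΣFin (inside ∷ S)  = cong suc (size≡ΣFin S)
size≡ΣFin (outside ∷ S) = size≡ΣFin S

size-nonZero : ∀ {n} {x : Fin n} {S : Subset n} → x ∈ S → NonZero ∣ S ∣
size-nonZero {S = inside ∷ S}  here        = _
size-nonZero {S = inside ∷ S}  (there x∈S) = _
size-nonZero {S = outside ∷ S} (there x∈S) = size-nonZero x∈S

bool→ℕ-∧ : ∀ u v → bool→ℕ (u ∧ v) ≡ bool→ℕ u * bool→ℕ v
bool→ℕ-∧ true  v = sym (+-identityʳ (bool→ℕ v))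
bool→ℕ-∧ false v = refl

-- Cross cancellation: if x q + y p = y q + x p with p ≠ q, then x = y,
-- i.e. (x - y)(q - p) = 0 forces x = y.  We first treat y = x + e.
cross-cancel-shifted : ∀ {p q} x e → p ≢ q → x * q + (x + e) * p ≡ (x + e) * q + x * p → x ≡ x + e
cross-cancel-shifted x zero    p≢q eq = sym (+-identityʳ x)
cross-cancel-shifted {p} {q} x (suc d) p≢q eq =
  ⊥-elim (p≢q (*-cancelˡ-≡ p q (suc d) (+-cancelˡ-≡ (x * q + x * p) _ _ (begin
    x * q + x * p + suc d * p  ≡⟨ regroupˡ x (suc d) p q ⟩
    x * q + (x + suc d) * p    ≡⟨ eq ⟩
    (x + suc d) * q + x * p    ≡⟨ regroupʳ x (suc d) p q ⟩
    x * q + x * p + suc d * q  ∎))))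
  where
  regroupˡ : ∀ x e p q → x * q + x * p + e * p ≡ x * q + (x + e) * p
  regroupˡ = solve-∀
  regroupʳ : ∀ x e p q → (x + e) * q + x * p ≡ x * q + x * p + e * q
  regroupʳ = solve-∀

cross-cancel : ∀ {p q} x y → p ≢ q → x * q + y * p ≡ y * q + x * p → x ≡ y
cross-cancel x y p≢q eq with ≤-total x y
... | inj₁ x≤y with m≤n⇒∃[o]m+o≡n x≤y
...   | e , refl = cross-cancel-shifted x e p≢q eq
cross-cancel x y p≢q eq | inj₂ y≤x with m≤n⇒∃[o]m+o≡n y≤x
...   | e , refl = sym (cross-cancel-shifted y e p≢q (sym eq))

module DifferenceCounts {n : ℕ} (G : FinAbGroup n) where
  open FinAbGroup G

  group : Group 0ℓ 0ℓ
  group = record { isGroup = IsAbelianGroup.isGroup isAbelianGroup }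

  open GroupProperties group using (x∙y⁻¹≈ε⇒x≈y; ⁻¹-anti-homo-//; ⁻¹-involutive; ε⁻¹≈ε)

  D : Subset n → Subset n → Fin n → ℕ
  D S T δ = ΣFin n (λ a → ΣFin n (λ b → bool→ℕ (lookup S a ∧ lookup T b ∧ does ((a ⊝ b) ≟ δ))))

  ⊖-involutive : ∀ δ → ⊖ (⊖ δ) ≡ δ
  ⊖-involutive = ⁻¹-involutive

  ⊖-nonzero : ∀ δ → δ ≢ 𝟘 → ⊖ δ ≢ 𝟘
  ⊖-nonzero δ δ≢𝟘 ⊖δ≡𝟘 = δ≢𝟘 (trans (sym (⊖-involutive δ)) (trans (cong ⊖_ ⊖δ≡𝟘) ε⁻¹≈ε))

  disjoint-difference : ∀ {S T a b} → (∀ x → x ∈ S → x ∈ T → ⊥) → a ∈ S → b ∈ T → a ⊝ b ≢ 𝟘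
  disjoint-difference {T = T} {a} {b} disjoint a∈S b∈T a-b≡𝟘 =
    disjoint a a∈S (subst (_∈ T) (sym (x∙y⁻¹≈ε⇒x≈y a b a-b≡𝟘)) b∈T)

  D-zero : ∀ S T → (∀ x → x ∈ S → x ∈ T → ⊥) → D S T 𝟘 ≡ 0
  D-zero S T disjoint = ΣFin-zero n (λ a → ΣFin-zero n (λ b → no-pair a b))
    where
    no-pair : ∀ a b → bool→ℕ (lookup S a ∧ lookup T b ∧ does ((a ⊝ b) ≟ 𝟘)) ≡ 0
    no-pair a b with lookup S a in a∈S | lookup T b in b∈T | (a ⊝ b) ≟ 𝟘
    ... | true  | true  | yes a-b≡𝟘 =
      ⊥-elim (disjoint-difference disjoint (lookup⇒[]= a S a∈S) (lookup⇒[]= b T b∈T) a-b≡𝟘)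
    ... | true  | true  | no _ = refl
    ... | true  | false | _    = refl
    ... | false | _     | _    = refl

  -- (ii) Every pair of S × T has exactly one difference.
  D-total : ∀ S T → ΣFin n (D S T) ≡ ∣ S ∣ * ∣ T ∣
  D-total S T = begin
      ΣFin n (D S T)
    ≡⟨ ΣFin-swap n n _ ⟩
      ΣFin n (λ a → ΣFin n (λ δ → ΣFin n (λ b → pair a b δ)))
    ≡⟨ ΣFin-cong n (λ a → ΣFin-swap n n _) ⟩
      ΣFin n (λ a → ΣFin n (λ b → ΣFin n (pair a b)))
    ≡⟨ ΣFin-cong n (λ a → ΣFin-cong n (λ b → one-difference a b)) ⟩
      ΣFin n (λ a → ΣFin n (λ b → 𝟙S a * 𝟙T b))
    ≡⟨ ΣFin-cong n (λ a → ΣFin-*ˡ n (𝟙S a) 𝟙T) ⟩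
      ΣFin n (λ a → 𝟙S a * ΣFin n 𝟙T)
    ≡⟨ ΣFin-*ʳ n (ΣFin n 𝟙T) 𝟙S ⟩
      ΣFin n 𝟙S * ΣFin n 𝟙T
    ≡⟨ sym (cong₂ _*_ (size≡ΣFin S) (size≡ΣFin T)) ⟩
      ∣ S ∣ * ∣ T ∣ ∎
    where
    𝟙S 𝟙T : Fin n → ℕ
    𝟙S a = bool→ℕ (lookup S a)
    𝟙T b = bool→ℕ (lookup T b)
    pair : Fin n → Fin n → Fin n → ℕ
    pair a b δ = bool→ℕ (lookup S a ∧ lookup T b ∧ does ((a ⊝ b) ≟ δ))
    one-difference : ∀ a b → ΣFin n (pair a b) ≡ 𝟙S a * 𝟙T b
    one-difference a b = begin
        ΣFin n (pair a b)
      ≡⟨ ΣFin-cong n (λ δ → trans (bool→ℕ-∧ (lookup S a) _) (cong (𝟙S a *_) (bool→ℕ-∧ (lookup T b) _))) ⟩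
        ΣFin n (λ δ → 𝟙S a * (𝟙T b * bool→ℕ (does ((a ⊝ b) ≟ δ))))
      ≡⟨ ΣFin-*ˡ n (𝟙S a) _ ⟩
        𝟙S a * ΣFin n (λ δ → 𝟙T b * bool→ℕ (does ((a ⊝ b) ≟ δ)))
      ≡⟨ cong (𝟙S a *_) (ΣFin-*ˡ n (𝟙T b) _) ⟩
        𝟙S a * (𝟙T b * ΣFin n (λ δ → bool→ℕ (does ((a ⊝ b) ≟ δ))))
      ≡⟨ cong (λ s → 𝟙S a * (𝟙T b * s)) (ΣFin-indicator n (a ⊝ b)) ⟩
        𝟙S a * (𝟙T b * 1)
      ≡⟨ cong (𝟙S a *_) (*-identityʳ (𝟙T b)) ⟩
        𝟙S a * 𝟙T b ∎

  -- (iii) a - b = δ exactly when b - a = -δ.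
  D-swap : ∀ S T δ → D S T δ ≡ D T S (⊖ δ)
  D-swap S T δ = trans (ΣFin-swap n n _) (ΣFin-cong n (λ b → ΣFin-cong n (λ a →
    cong bool→ℕ (trans (∧-exchange (lookup S a) (lookup T b) _)
      (cong (λ t → lookup T b ∧ lookup S a ∧ t)
        (does-⇔ (mk⇔ (λ a-b≡δ → trans (sym (⁻¹-anti-homo-// a b)) (cong ⊖_ a-b≡δ))
                     (λ b-a≡⊖δ → trans (sym (⁻¹-anti-homo-// b a))
                                   (trans (cong ⊖_ b-a≡⊖δ) (⊖-involutive δ))))
                ((a ⊝ b) ≟ δ) ((b ⊝ a) ≟ ⊖ δ)))))))
    where
    ∧-exchange : ∀ u v w → u ∧ v ∧ w ≡ v ∧ u ∧ w
    ∧-exchange u v w = trans (sym (∧-assoc u v w)) (trans (cong (_∧ w) (∧-comm u v)) (∧-assoc v u w))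

module TwoMemberFamilies {n : ℕ} (G : FinAbGroup n) (A : Fin 2 → Subset n) where
  open DifferenceCounts G using (D)

  N-first : ∀ δ → N G A zero δ ≡ D (A zero) (A (suc zero)) δ
  N-first δ = ΣFin-cong n (λ a → ΣFin-cong n (λ b →
    cong (λ t → bool→ℕ (lookup (A zero) a ∧ t ∧ _)) (∨-identityʳ (lookup (A (suc zero)) b))))

  N-second : ∀ δ → N G A (suc zero) δ ≡ D (A (suc zero)) (A zero) δ
  N-second δ = ΣFin-cong n (λ a → ΣFin-cong n (λ b →
    cong (λ t → bool→ℕ (lookup (A (suc zero)) a ∧ t ∧ _)) (∨-identityʳ (lookup (A zero) b))))

-- Throughout this section {A₁, A₂} is a two-set RWEDF in a group of order
-- n = m + 2 (smaller groups cannot carry two disjoint nonempty sets), with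
-- sizes p, q, counts N₁, N₂ and balance constant c.
module TwoSetRWEDF {m : ℕ} (G : FinAbGroup (suc (suc m))) (A : Fin 2 → Subset (suc (suc m)))
                   (k : Fin 2 → ℕ) (ℓ : ℚ) (rwedf : IsRWEDF G A k ℓ) where
  open FinAbGroup G
  open DifferenceCounts G
  open TwoMemberFamilies G A

  n : ℕ
  n = suc (suc m)

  disjoint : ∀ x → x ∈ A zero → x ∈ A (suc zero) → ⊥
  disjoint = proj₁ (proj₁ rwedf) zero (suc zero) (λ ())

  nonempty : ∀ i → Σ (Fin n) (_∈ A i)
  nonempty = proj₁ (proj₂ (proj₁ rwedf))

  sizes : ∀ i → ∣ A i ∣ ≡ k i
  sizes = proj₂ (proj₂ (proj₁ rwedf))

  p q : ℕ
  p = k zero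
  q = k (suc zero)

  instance
    p-nonZero : NonZero p
    p-nonZero = subst NonZero (sizes zero) (size-nonZero (proj₂ (nonempty zero)))
    q-nonZero : NonZero q
    q-nonZero = subst NonZero (sizes (suc zero)) (size-nonZero (proj₂ (nonempty (suc zero))))
    pq-nonZero : NonZero (p * q)
    pq-nonZero = m*n≢0 p q
    p+q-nonZero : NonZero (p + q)
    p+q-nonZero = +-nonZero p q
      where
      +-nonZero : ∀ a b .{{_ : NonZero a}} → NonZero (a + b)
      +-nonZero (suc a) b = _

  N₁ N₂ : Fin n → ℕ
  N₁ = N G A zero
  N₂ = N G A (suc zero)

  N₁-𝟘 : N₁ 𝟘 ≡ 0
  N₁-𝟘 = trans (N-first 𝟘) (D-zero (A zero) (A (suc zero)) disjoint)

  N₂-𝟘 : N₂ 𝟘 ≡ 0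
  N₂-𝟘 = trans (N-second 𝟘) (D-zero (A (suc zero)) (A zero) (λ x x∈A₂ x∈A₁ → disjoint x x∈A₁ x∈A₂))

  ΣN₁ : ΣFin n N₁ ≡ p * q
  ΣN₁ = trans (ΣFin-cong n N-first)
              (trans (D-total (A zero) (A (suc zero))) (cong₂ _*_ (sizes zero) (sizes (suc zero))))

  ΣN₂ : ΣFin n N₂ ≡ q * p
  ΣN₂ = trans (ΣFin-cong n N-second)
              (trans (D-total (A (suc zero)) (A zero)) (cong₂ _*_ (sizes (suc zero)) (sizes zero)))

  N₂≡N₁∘⊖ : ∀ δ → N₂ δ ≡ N₁ (⊖ δ)
  N₂≡N₁∘⊖ δ = trans (N-second δ) (trans (D-swap (A (suc zero)) (A zero) δ) (sym (N-first (⊖ δ))))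

  δ₀ : Fin n
  δ₀ = proj₁ (nonempty zero) ⊝ proj₁ (nonempty (suc zero))

  δ₀≢𝟘 : δ₀ ≢ 𝟘
  δ₀≢𝟘 = disjoint-difference disjoint (proj₂ (nonempty zero)) (proj₂ (nonempty (suc zero)))

  ℓ-fraction : ∀ δ → δ ≢ 𝟘 → ℓ ≡ divℕ (N₁ δ * q + N₂ δ * p) (p * q)
  ℓ-fraction δ δ≢𝟘 = begin
    ℓ                                          ≡⟨ sym (proj₂ rwedf δ δ≢𝟘) ⟩
    divℕ (N₁ δ) p +ℚ (divℕ (N₂ δ) q +ℚ 0ℚ)     ≡⟨ cong (divℕ (N₁ δ) p +ℚ_) (ℚ.+-identityʳ _) ⟩
    divℕ (N₁ δ) p +ℚ divℕ (N₂ δ) q             ≡⟨ divℕ-+ (N₁ δ) (N₂ δ) p q ⟩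
    divℕ (N₁ δ * q + N₂ δ * p) (p * q)         ∎

  c : ℕ
  c = N₁ δ₀ * q + N₂ δ₀ * p

  balance : ∀ δ → δ ≢ 𝟘 → N₁ δ * q + N₂ δ * p ≡ c
  balance δ δ≢𝟘 = divℕ-injectiveˡ _ c (p * q) (trans (sym (ℓ-fraction δ δ≢𝟘)) (ℓ-fraction δ₀ δ₀≢𝟘))

  -- Summing the balance over the n - 1 nonzero differences.
  total-balance : suc m * c ≡ (p + q) * (p * q)
  total-balance = begin
    suc m * c                                  ≡⟨ sym (ΣFin-punctured n c weighted 𝟘 weighted-𝟘 balance) ⟩
    ΣFin n weighted                            ≡⟨ ΣFin-+ n (λ δ → N₁ δ * q) (λ δ → N₂ δ * p) ⟩
    ΣFin n (λ δ → N₁ δ * q) + ΣFin n (λ δ → N₂ δ * p)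
                                               ≡⟨ cong₂ _+_ (ΣFin-*ʳ n q N₁) (ΣFin-*ʳ n p N₂) ⟩
    ΣFin n N₁ * q + ΣFin n N₂ * p              ≡⟨ cong₂ (λ s t → s * q + t * p) ΣN₁ ΣN₂ ⟩
    p * q * q + q * p * p                      ≡⟨ factor p q ⟩
    (p + q) * (p * q)                          ∎
    where
    weighted : Fin n → ℕ
    weighted δ = N₁ δ * q + N₂ δ * p
    weighted-𝟘 : weighted 𝟘 ≡ 0
    weighted-𝟘 = cong₂ (λ s t → s * q + t * p) N₁-𝟘 N₂-𝟘
    factor : ∀ p q → p * q * q + q * p * p ≡ (p + q) * (p * q)
    factor = solve-∀

  ℓ-value : ℓ ≡ divℕ (p + q) (suc m)
  ℓ-value = trans (ℓ-fraction δ₀ δ₀≢𝟘)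
                  (divℕ-cross⇒≡ c (p + q) (p * q) (suc m) (trans (*-comm c (suc m)) total-balance))

  module EqualSizes (p≡q : p ≡ q) where
    λ₀ : ℕ
    λ₀ = N₁ δ₀ + N₂ δ₀

    combined : ∀ δ → δ ≢ 𝟘 → (N₁ δ + N₂ δ) * p ≡ c
    combined δ δ≢𝟘 = begin
      (N₁ δ + N₂ δ) * p      ≡⟨ *-distribʳ-+ p (N₁ δ) (N₂ δ) ⟩
      N₁ δ * p + N₂ δ * p    ≡⟨ cong (λ r → N₁ δ * r + N₂ δ * p) p≡q ⟩
      N₁ δ * q + N₂ δ * p    ≡⟨ balance δ δ≢𝟘 ⟩
      c                      ∎

    constant : ∀ δ → δ ≢ 𝟘 → ΣFin 2 (λ i → N G A i δ) ≡ λ₀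
    constant δ δ≢𝟘 = trans (cong (N₁ δ +_) (+-identityʳ (N₂ δ)))
      (*-cancelʳ-≡ _ _ p (trans (combined δ δ≢𝟘) (sym (combined δ₀ δ₀≢𝟘))))

    family : IsFamily G A (λ _ → p)
    family = proj₁ (proj₁ rwedf) , nonempty ,
             λ { zero → sizes zero ; (suc zero) → trans (sizes (suc zero)) (sym p≡q) }

    λ-value : divℕ λ₀ 1 ≡ divℕ (2 * p * p) (suc m)
    λ-value = divℕ-cross⇒≡ λ₀ (2 * p * p) 1 (suc m) (*-cancelʳ-≡ _ _ p (begin
      λ₀ * suc m * p          ≡⟨ reassociate λ₀ (suc m) p ⟩
      suc m * (λ₀ * p)        ≡⟨ cong (suc m *_) (combined δ₀ δ₀≢𝟘) ⟩
      suc m * c               ≡⟨ total-balance ⟩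
      (p + q) * (p * q)       ≡⟨ cong (λ r → (p + r) * (p * r)) (sym p≡q) ⟩
      (p + p) * (p * p)       ≡⟨ double p ⟩
      2 * p * p * 1 * p       ∎))
      where
      reassociate : ∀ l s p → l * s * p ≡ s * (l * p)
      reassociate = solve-∀
      double : ∀ p → (p + p) * (p * p) ≡ 2 * p * p * 1 * p
      double = solve-∀

    edf : Σ ℕ (λ λ' → IsEDF G A p λ' × (divℕ λ' 1 ≡ divℕ (2 * p * p) (suc m)))
    edf = λ₀ , (family , constant) , λ-value

  -- Distinct sizes: comparing δ with -δ forces N₁ = N₂, both constant: a GSEDF.
  module DistinctSizes (p≢q : p ≢ q) where
    balance-reflected : ∀ δ → δ ≢ 𝟘 → N₂ δ * q + N₁ δ * p ≡ c
    balance-reflected δ δ≢𝟘 = begin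
      N₂ δ * q + N₁ δ * p                ≡⟨ cong₂ (λ s t → s * q + t * p) (N₂≡N₁∘⊖ δ) N₁≡N₂∘⊖ ⟩
      N₁ (⊖ δ) * q + N₂ (⊖ δ) * p        ≡⟨ balance (⊖ δ) (⊖-nonzero δ δ≢𝟘) ⟩
      c                                  ∎
      where
      N₁≡N₂∘⊖ : N₁ δ ≡ N₂ (⊖ δ)
      N₁≡N₂∘⊖ = trans (cong N₁ (sym (⊖-involutive δ))) (sym (N₂≡N₁∘⊖ (⊖ δ)))

    N₁≡N₂ : ∀ δ → δ ≢ 𝟘 → N₁ δ ≡ N₂ δ
    N₁≡N₂ δ δ≢𝟘 = cross-cancel (N₁ δ) (N₂ δ) p≢q
      (trans (balance δ δ≢𝟘) (sym (balance-reflected δ δ≢𝟘)))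

    λ₀ : ℕ
    λ₀ = N₁ δ₀

    shared : ∀ δ → δ ≢ 𝟘 → N₁ δ * (p + q) ≡ c
    shared δ δ≢𝟘 = begin
      N₁ δ * (p + q)          ≡⟨ spread (N₁ δ) p q ⟩
      N₁ δ * q + N₁ δ * p     ≡⟨ cong (λ s → N₁ δ * q + s * p) (N₁≡N₂ δ δ≢𝟘) ⟩
      N₁ δ * q + N₂ δ * p     ≡⟨ balance δ δ≢𝟘 ⟩
      c                       ∎
      where
      spread : ∀ x p q → x * (p + q) ≡ x * q + x * p
      spread = solve-∀

    N₁-constant : ∀ δ → δ ≢ 𝟘 → N₁ δ ≡ λ₀
    N₁-constant δ δ≢𝟘 = *-cancelʳ-≡ _ _ (p + q) (trans (shared δ δ≢𝟘) (sym (shared δ₀ δ₀≢𝟘)))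

    constant : ∀ i δ → δ ≢ 𝟘 → N G A i δ ≡ λ₀
    constant zero       δ δ≢𝟘 = N₁-constant δ δ≢𝟘
    constant (suc zero) δ δ≢𝟘 = trans (sym (N₁≡N₂ δ δ≢𝟘)) (N₁-constant δ δ≢𝟘)

    λ-value : divℕ λ₀ 1 ≡ divℕ (p * q) (suc m)
    λ-value = divℕ-cross⇒≡ λ₀ (p * q) 1 (suc m) (*-cancelʳ-≡ _ _ (p + q) (begin
      λ₀ * suc m * (p + q)    ≡⟨ reassociate λ₀ (suc m) (p + q) ⟩
      suc m * (λ₀ * (p + q))  ≡⟨ cong (suc m *_) (shared δ₀ δ₀≢𝟘) ⟩
      suc m * c               ≡⟨ total-balance ⟩
      (p + q) * (p * q)       ≡⟨ commute (p + q) (p * q) ⟩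
      p * q * 1 * (p + q)     ∎))
      where
      reassociate : ∀ l s r → l * s * r ≡ s * (l * r)
      reassociate = solve-∀
      commute : ∀ r s → r * s ≡ s * 1 * r
      commute = solve-∀

    gsedf : Σ ℕ (λ λ' → IsGSEDF G A k (λ _ → λ') × (divℕ λ' 1 ≡ divℕ (p * q) (suc m)))
    gsedf = λ₀ , (proj₁ rwedf , constant) , λ-value

  conclusion : (ℓ ≡ divℕ (p + q) (suc m)) ×
               ((p ≡ q × Σ ℕ (λ λ' → IsEDF G A p λ' × (divℕ λ' 1 ≡ divℕ (2 * p * p) (suc m))))
                ⊎ Σ ℕ (λ λ' → IsGSEDF G A k (λ _ → λ') × (divℕ λ' 1 ≡ divℕ (p * q) (suc m))))
  conclusion with p ℕ.≟ q
  ... | yes p≡q = ℓ-value , inj₁ (p≡q , EqualSizes.edf p≡q)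
  ... | no  p≢q = ℓ-value , inj₂ (DistinctSizes.gsedf p≢q)

mainTheorem5 : {n : ℕ} (G : FinAbGroup n) (A : Fin 2 → Subset n) (k : Fin 2 → ℕ) (ℓ : ℚ) →
  IsRWEDF G A k ℓ →
  (ℓ ≡ divℕ (k zero + k (suc zero)) (n ∸ 1)) ×
  ((k zero ≡ k (suc zero) ×
     Σ ℕ (λ λ' → IsEDF G A (k zero) λ' × (divℕ λ' 1 ≡ divℕ (2 * k zero * k zero) (n ∸ 1))))
   ⊎
   Σ ℕ (λ λ' → IsGSEDF G A k (λ _ → λ') × (divℕ λ' 1 ≡ divℕ (k zero * k (suc zero)) (n ∸ 1))))
-- Groups of order 0 or 1 cannot contain two disjoint nonempty sets.
mainTheorem5 {zero} G A k ℓ ((_ , nonempty , _) , _) with nonempty zero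
... | () , _
mainTheorem5 {suc zero} G A k ℓ ((disjoint , nonempty , _) , _) with nonempty zero | nonempty (suc zero)
... | zero , x∈A₁ | zero , x∈A₂ = ⊥-elim (disjoint zero (suc zero) (λ ()) zero x∈A₁ x∈A₂)
mainTheorem5 {suc (suc m)} G A k ℓ rwedf = TwoSetRWEDF.conclusion G A k ℓ rwedf
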